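{- Let $T_1,T_2,\dots,T_k$ be piecewise linear bijections on the integers in the range $[0,n)$, and let $T=T_k\circ\cdots\circ T_2\circ T_1$ be their composition. Then there exists a single piecewise linear bijection $\widehat T$ on the integers in the range $[0,kn)$ such that $T(x)=\widehat T^{(k)}(x)$ for all integers $x\in[0,n)$. The number of pieces needed to define $\widehat T$ is the sum of the numbers of pieces of the $T_i$.
   Context: A piecewise linear bijection on the integers in a range $[L,R)$ is specified by integer endpoints dividing $[L,R)$ into consecutive intervals (pieces) and, for each piece $I_j$, integer coefficients $a_j,b_j$, such that $x\mapsto a_jx+b_j$ for $x\in I_j$ defines a bijection of the integers in $[L,R)$. $\widehat T^{(k)}$ denotes the $k$-fold iterate. -}

module Defs where

open import Data.Nat using (ℕ; zero; suc)
open import Data.Integer using (ℤ; _+_; _*_; _≤_; _<_; _<?_)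
open import Data.Fin using (Fin; zero; suc; fromℕ; inject₁)
open import Data.Vec using (Vec; []; _∷_)
open import Data.Product using (Σ; _×_)
open import Relation.Binary.PropositionalEquality using (_≡_)
open import Relation.Nullary using (yes; no)
open import Function using (_∘_)

-- Evaluation of a piecewise linear map given by endpoints
-- e 0 < e 1 < ... < e m and coefficients a j, b j: for x in
-- [e j, e (j+1)) the value is a j * x + b j.  Pieces are searched
-- left to right (first j with x < e (j+1)); outside all pieces the
-- value is x (irrelevant for points of the domain [e 0, e m)).
evalPL : (m : ℕ) → (Fin (suc m) → ℤ) → (Fin m → ℤ) → (Fin m → ℤ) → ℤ → ℤ
evalPL zero    e a b x = x
evalPL (suc m) e a b x with x <? e (suc zero)
... | yes _ = a zero * x + b zero
... | no  _ = evalPL m (e ∘ suc) (a ∘ suc) (b ∘ suc) x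

IsBijOn : ℤ → ℤ → (ℤ → ℤ) → Set
IsBijOn L R f =
    (∀ x → L ≤ x → x < R → (L ≤ f x × f x < R))
  × (∀ x y → L ≤ x → x < R → L ≤ y → y < R → f x ≡ f y → x ≡ y)
  × (∀ y → L ≤ y → y < R → Σ ℤ λ x → L ≤ x × x < R × f x ≡ y)

record PLBij (L R : ℤ) : Set where
  field
    m       : ℕ
    e       : Fin (suc m) → ℤ
    a       : Fin m → ℤ
    b       : Fin m → ℤ
    e-first : e zero ≡ L
    e-last  : e (fromℕ m) ≡ R
    e-incr  : ∀ j → e (inject₁ j) < e (suc j)
    bij     : IsBijOn L R (evalPL m e a b)

  apply : ℤ → ℤ
  apply = evalPL m e a b

open PLBij public

-- composition T_k ∘ ... ∘ T_1 (first element of the vector applied first)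
applySeq : ∀ {L R k} → Vec (PLBij L R) k → ℤ → ℤ
applySeq []       x = x
applySeq (T ∷ Ts) x = applySeq Ts (apply T x)

iter : ℕ → (ℤ → ℤ) → ℤ → ℤ
iter zero    f x = x
iter (suc k) f x = f (iter k f x)

-- Lay k copies of [0, n) side by side as the blocks [i n, (i+1) n) of [0, k n).
-- On block i the map T̂ is T_{i+1} conjugated by translations so that it lands in
-- block i+1; on the last block it is T_k landing back in block 0.  Each block thus
-- goes bijectively onto the next one, cyclically, so T̂ is a bijection whose pieces
-- are the translated pieces of the T_i.  Starting from x in block 0, the iterates of
-- T̂ visit blocks 1, ..., k-1 carrying T_i ∘ ⋯ ∘ T_1 (x) as offset inside the block,
-- and the k-th iterate is back in block 0 at T(x).
module Submission where

open import Algebra.Bundles using (AbelianGroup)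
open import Data.Empty using (⊥-elim)
open import Data.Fin using (Fin; zero; suc; fromℕ; inject₁; splitAt)
open import Data.Integer using (ℤ; +_; 0ℤ; _+_; _-_; -_; _≤_; _<_; _<?_; +≤+)
import Data.Integer as ℤ
open import Data.Integer.Properties
open import Data.Integer.Tactic.RingSolver using (solve-∀)
open import Data.Nat as ℕ using (ℕ; zero; suc; _*_)
import Data.Nat.Properties as ℕₚ
open import Data.Product using (Σ; ∃-syntax; _×_; _,_; proj₁)
open import Data.Sum as Sum using (_⊎_; inj₁; inj₂; map₁; swap; assocˡ; assocʳ)
open import Data.Sum.Properties using ([,]-map)
open import Data.Vec using (Vec; []; _∷_; sum; map)
open import Data.Vec.Functional using (tail; _++_)
open import Function using (_∘_)
open import Relation.Binary.PropositionalEquality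
open import Relation.Nullary using (¬_; yes; no)

open import Defs

open import Algebra.Properties.Group (AbelianGroup.group +-0-abelianGroup)
  using (//-rightDividesˡ; //-rightDividesʳ; ∙-cancelʳ)

infix 4 _∈[_,_⟩

_∈[_,_⟩ : ℤ → ℤ → ℤ → Set
x ∈[ L , R ⟩ = L ≤ x × x < R

∈-empty : ∀ {x L} → ¬ x ∈[ L , L ⟩
∈-empty (L≤x , x<L) = <-irrefl refl (≤-<-trans L≤x x<L)

-- Case splits on evalPL go through this rather than _<?_: a with on x <? y would also
-- abstract the identical test inside the unfolded evalPL in the goal.
<⊎≥ : ∀ x y → x < y ⊎ y ≤ x
<⊎≥ x y with x <? y
... | yes x<y = inj₁ x<y
... | no  x≮y = inj₂ (≮⇒≥ x≮y)

∈-split : ∀ {x L R} M → x ∈[ L , R ⟩ → x ∈[ L , M ⟩ ⊎ x ∈[ M , R ⟩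
∈-split {x} M (L≤x , x<R) = Sum.map (L≤x ,_) (_, x<R) (<⊎≥ x M)

∈-merge : ∀ {x L M R} → L ≤ M → M ≤ R → x ∈[ L , M ⟩ ⊎ x ∈[ M , R ⟩ → x ∈[ L , R ⟩
∈-merge L≤M M≤R (inj₁ (L≤x , x<M)) = L≤x , <-≤-trans x<M M≤R
∈-merge L≤M M≤R (inj₂ (M≤x , x<R)) = ≤-trans L≤M M≤x , x<R

∈-translate : ∀ {x L R} t → x ∈[ L , R ⟩ → x + t ∈[ L + t , R + t ⟩
∈-translate t (L≤x , x<R) = +-monoˡ-≤ t L≤x , +-monoˡ-< t x<R

∈-from-origin : ∀ {u N} s → u ∈[ 0ℤ , N ⟩ → u + s ∈[ s , s + N ⟩
∈-from-origin {u} {N} s u∈ =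
  subst₂ (λ L R → u + s ∈[ L , R ⟩) (+-identityˡ s) (+-comm N s) (∈-translate s u∈)

∈-to-origin : ∀ {x N} s → x ∈[ s , s + N ⟩ → x - s ∈[ 0ℤ , N ⟩
∈-to-origin {x} {N} s x∈ =
  subst₂ (λ L R → x - s ∈[ L , R ⟩) (+-inverseʳ s) s+N-s≡N (∈-translate (- s) x∈)
  where
  s+N-s≡N : s + N - s ≡ N
  s+N-s≡N = trans (cong (_- s) (+-comm s N)) (//-rightDividesʳ s N)

record BijOnto (L R : ℤ) (P : ℤ → Set) (f : ℤ → ℤ) : Set where
  field
    into : ∀ {x} → x ∈[ L , R ⟩ → P (f x)
    inj  : ∀ {x y} → x ∈[ L , R ⟩ → y ∈[ L , R ⟩ → f x ≡ f y → x ≡ y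
    onto : ∀ {y} → P y → ∃[ x ] x ∈[ L , R ⟩ × f x ≡ y

toIsBijOn : ∀ {L R f} → BijOnto L R (_∈[ L , R ⟩) f → IsBijOn L R f
toIsBijOn F =
    (λ x L≤x x<R → into (L≤x , x<R))
  , (λ x y L≤x x<R L≤y y<R → inj (L≤x , x<R) (L≤y , y<R))
  , λ y L≤y y<R → let (x , (L≤x , x<R) , fx≡y) = onto (L≤y , y<R) in x , L≤x , x<R , fx≡y
  where open BijOnto F

BijOnto-resp-≗ : ∀ {L R P f g} → (∀ {x} → x ∈[ L , R ⟩ → f x ≡ g x) →
                 BijOnto L R P f → BijOnto L R P g
BijOnto-resp-≗ {P = P} f≡g F = record
  { into = λ x∈ → subst P (f≡g x∈) (into x∈)
  ; inj  = λ x∈ y∈ gx≡gy → inj x∈ y∈ (trans (f≡g x∈) (trans gx≡gy (sym (f≡g y∈))))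
  ; onto = λ Py → let (x , x∈ , fx≡y) = onto Py in x , x∈ , trans (sym (f≡g x∈)) fx≡y
  }
  where open BijOnto F

BijOnto-resp-⇔ : ∀ {L R P Q f} → (∀ {y} → P y → Q y) → (∀ {y} → Q y → P y) →
                 BijOnto L R P f → BijOnto L R Q f
BijOnto-resp-⇔ P⇒Q Q⇒P F = record { into = P⇒Q ∘ into ; inj = inj ; onto = onto ∘ Q⇒P }
  where open BijOnto F

BijOnto-⊎ : ∀ {L M R P Q f} → L ≤ M → M ≤ R → (∀ {y} → P y → ¬ Q y) →
            BijOnto L M P f → BijOnto M R Q f → BijOnto L R (λ y → P y ⊎ Q y) f
BijOnto-⊎ {L} {M} {R} {P} {Q} {f} L≤M M≤R disjoint F G = record { into = into ; inj = inj ; onto = onto }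
  where
  module F = BijOnto F
  module G = BijOnto G

  into : ∀ {x} → x ∈[ L , R ⟩ → P (f x) ⊎ Q (f x)
  into = Sum.map F.into G.into ∘ ∈-split M

  inj : ∀ {x y} → x ∈[ L , R ⟩ → y ∈[ L , R ⟩ → f x ≡ f y → x ≡ y
  inj x∈ y∈ fx≡fy with ∈-split M x∈ | ∈-split M y∈
  ... | inj₁ x∈ˡ | inj₁ y∈ˡ = F.inj x∈ˡ y∈ˡ fx≡fy
  ... | inj₂ x∈ʳ | inj₂ y∈ʳ = G.inj x∈ʳ y∈ʳ fx≡fy
  ... | inj₁ x∈ˡ | inj₂ y∈ʳ = ⊥-elim (disjoint (F.into x∈ˡ) (subst Q (sym fx≡fy) (G.into y∈ʳ)))
  ... | inj₂ x∈ʳ | inj₁ y∈ˡ = ⊥-elim (disjoint (F.into y∈ˡ) (subst Q fx≡fy (G.into x∈ʳ)))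

  onto : ∀ {y} → P y ⊎ Q y → ∃[ x ] x ∈[ L , R ⟩ × f x ≡ y
  onto (inj₁ Py) = let (x , x∈ , fx≡y) = F.onto Py in x , ∈-merge L≤M M≤R (inj₁ x∈) , fx≡y
  onto (inj₂ Qy) = let (x , x∈ , fx≡y) = G.onto Qy in x , ∈-merge L≤M M≤R (inj₂ x∈) , fx≡y

BijOnto-translate : ∀ {N F g} s t → IsBijOn 0ℤ N F →
                    (∀ {u} → u ∈[ 0ℤ , N ⟩ → g (u + s) ≡ F u + t) →
                    BijOnto s (s + N) (_∈[ t , t + N ⟩) g
BijOnto-translate {N} {F} {g} s t (F-into , F-inj , F-onto) g≡F =
  record { into = into ; inj = inj ; onto = onto }
  where
  F-into′ : ∀ {u} → u ∈[ 0ℤ , N ⟩ → F u ∈[ 0ℤ , N ⟩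
  F-into′ (0≤u , u<N) = F-into _ 0≤u u<N

  g≡F-origin : ∀ {x} → x ∈[ s , s + N ⟩ → g x ≡ F (x - s) + t
  g≡F-origin {x} x∈ = trans (cong g (sym (//-rightDividesˡ s x))) (g≡F (∈-to-origin s x∈))

  into : ∀ {x} → x ∈[ s , s + N ⟩ → g x ∈[ t , t + N ⟩
  into x∈ = subst (_∈[ t , t + N ⟩) (sym (g≡F-origin x∈))
                  (∈-from-origin t (F-into′ (∈-to-origin s x∈)))

  inj : ∀ {x y} → x ∈[ s , s + N ⟩ → y ∈[ s , s + N ⟩ → g x ≡ g y → x ≡ y
  inj {x} {y} x∈ y∈ gx≡gy =
    let (0≤x-s , x-s<N) = ∈-to-origin s x∈
        (0≤y-s , y-s<N) = ∈-to-origin s y∈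
        Fx≡Fy = ∙-cancelʳ t _ _ (trans (sym (g≡F-origin x∈)) (trans gx≡gy (g≡F-origin y∈)))
    in ∙-cancelʳ (- s) x y (F-inj _ _ 0≤x-s x-s<N 0≤y-s y-s<N Fx≡Fy)

  onto : ∀ {y} → y ∈[ t , t + N ⟩ → ∃[ x ] x ∈[ s , s + N ⟩ × g x ≡ y
  onto {y} y∈ =
    let (0≤y-t , y-t<N) = ∈-to-origin t y∈
        (u , 0≤u , u<N , Fu≡y-t) = F-onto (y - t) 0≤y-t y-t<N
    in u + s , ∈-from-origin s (0≤u , u<N) ,
       trans (g≡F (0≤u , u<N)) (trans (cong (_+ t) Fu≡y-t) (//-rightDividesˡ t y))

module _ {m} (e : Fin (suc (suc m)) → ℤ) (a b : Fin (suc m) → ℤ) {x : ℤ} where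

  evalPL-here : x < e (suc zero) → evalPL (suc m) e a b x ≡ a zero ℤ.* x + b zero
  evalPL-here x<e₁ with x <? e (suc zero)
  ... | yes _   = refl
  ... | no x≮e₁ = ⊥-elim (x≮e₁ x<e₁)

  evalPL-there : e (suc zero) ≤ x → evalPL (suc m) e a b x ≡ evalPL m (tail e) (tail a) (tail b) x
  evalPL-there e₁≤x with x <? e (suc zero)
  ... | yes x<e₁ = ⊥-elim (∈-empty (e₁≤x , x<e₁))
  ... | no _     = refl

evalPL-cong : ∀ m {e e′ a a′ b b′} → e ≗ e′ → a ≗ a′ → b ≗ b′ → evalPL m e a b ≗ evalPL m e′ a′ b′
evalPL-cong zero    _ _ _ _ = refl
evalPL-cong (suc m) {e} {e′} {a} {a′} {b} {b′} e≗e′ a≗a′ b≗b′ x with <⊎≥ x (e (suc zero))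
... | inj₁ x<e₁ = begin
  evalPL (suc m) e a b x    ≡⟨ evalPL-here e a b x<e₁ ⟩
  a zero ℤ.* x + b zero     ≡⟨ cong₂ (λ α β → α ℤ.* x + β) (a≗a′ zero) (b≗b′ zero) ⟩
  a′ zero ℤ.* x + b′ zero   ≡⟨ evalPL-here e′ a′ b′ (subst (x <_) (e≗e′ (suc zero)) x<e₁) ⟨
  evalPL (suc m) e′ a′ b′ x ∎
  where open ≡-Reasoning
... | inj₂ e₁≤x = begin
  evalPL (suc m) e a b x                        ≡⟨ evalPL-there e a b e₁≤x ⟩
  evalPL m (tail e) (tail a) (tail b) x         ≡⟨ evalPL-cong m (e≗e′ ∘ suc) (a≗a′ ∘ suc) (b≗b′ ∘ suc) x ⟩
  evalPL m (tail e′) (tail a′) (tail b′) x      ≡⟨ evalPL-there e′ a′ b′ (subst (_≤ x) (e≗e′ (suc zero)) e₁≤x) ⟨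
  evalPL (suc m) e′ a′ b′ x                     ∎
  where open ≡-Reasoning

tail-++ : ∀ {A : Set} {m n} (xs : Fin (suc m) → A) (ys : Fin n → A) → tail (xs ++ ys) ≗ tail xs ++ ys
tail-++ {m = m} xs ys i = [,]-map (splitAt m i)

record PLMap (m : ℕ) : Set where
  constructor plMap
  field
    endpoint  : Fin (suc m) → ℤ
    slope     : Fin m → ℤ
    intercept : Fin m → ℤ

open PLMap

⟦_⟧ : ∀ {m} → PLMap m → ℤ → ℤ
⟦_⟧ {m} P = evalPL m (endpoint P) (slope P) (intercept P)

start : ∀ {m} → PLMap m → ℤ
start P = endpoint P zero

end : ∀ {m} → PLMap m → ℤ
end {m} P = endpoint P (fromℕ m)

Increasing : ∀ {m} → PLMap m → Set
Increasing {m} P = ∀ (j : Fin m) → endpoint P (inject₁ j) < endpoint P (suc j)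

dropFirstPiece : ∀ {m} → PLMap (suc m) → PLMap m
dropFirstPiece P = plMap (tail (endpoint P)) (tail (slope P)) (tail (intercept P))

start≤end : ∀ {m} (P : PLMap m) → Increasing P → start P ≤ end P
start≤end {zero}  P _   = ≤-refl
start≤end {suc m} P inc = ≤-trans (<⇒≤ (inc zero)) (start≤end (dropFirstPiece P) (inc ∘ suc))

translate : ∀ {m} → ℤ → ℤ → PLMap m → PLMap m
translate s t P = plMap (λ i → endpoint P i + s) (slope P) (λ j → intercept P j - slope P j ℤ.* s + t)

⟦translate⟧ : ∀ {m} s t (P : PLMap m) {u} → u ∈[ start P , end P ⟩ →
              ⟦ translate s t P ⟧ (u + s) ≡ ⟦ P ⟧ u + t
⟦translate⟧ {zero}  s t P u∈ = ⊥-elim (∈-empty u∈)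
⟦translate⟧ {suc m} s t P@(plMap e a b) {u} (_ , u<end) with <⊎≥ u (e (suc zero))
... | inj₁ u<e₁ = begin
  ⟦ translate s t P ⟧ (u + s)                   ≡⟨ evalPL-here _ _ _ (+-monoˡ-< s u<e₁) ⟩
  a zero ℤ.* (u + s) + (b zero - a zero ℤ.* s + t) ≡⟨ affine (a zero) (b zero) u s t ⟩
  a zero ℤ.* u + b zero + t                       ≡⟨ cong (_+ t) (evalPL-here e a b u<e₁) ⟨
  ⟦ P ⟧ u + t                                   ∎
  where
  open ≡-Reasoning
  affine : ∀ α β u s t → α ℤ.* (u + s) + (β - α ℤ.* s + t) ≡ α ℤ.* u + β + t
  affine = solve-∀
... | inj₂ e₁≤u = begin
  ⟦ translate s t P ⟧ (u + s)                  ≡⟨ evalPL-there _ _ _ (+-monoˡ-≤ s e₁≤u) ⟩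
  ⟦ translate s t (dropFirstPiece P) ⟧ (u + s) ≡⟨ ⟦translate⟧ s t (dropFirstPiece P) (e₁≤u , u<end) ⟩
  ⟦ dropFirstPiece P ⟧ u + t                   ≡⟨ cong (_+ t) (evalPL-there e a b e₁≤u) ⟨
  ⟦ P ⟧ u + t                                  ∎
  where open ≡-Reasoning

infixr 5 _⊕_

-- The first endpoint of Q is dropped: it is meant to coincide with the last endpoint of P.
_⊕_ : ∀ {m n} → PLMap m → PLMap n → PLMap (m ℕ.+ n)
P ⊕ Q = plMap (endpoint P ++ tail (endpoint Q)) (slope P ++ slope Q) (intercept P ++ intercept Q)

⟦dropFirstPiece-⊕⟧ : ∀ {m n} (P : PLMap (suc m)) (Q : PLMap n) →
                     ⟦ dropFirstPiece (P ⊕ Q) ⟧ ≗ ⟦ dropFirstPiece P ⊕ Q ⟧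
⟦dropFirstPiece-⊕⟧ {m} {n} P Q =
  evalPL-cong (m ℕ.+ n) (tail-++ (endpoint P) _) (tail-++ (slope P) _) (tail-++ (intercept P) _)

end-⊕ : ∀ {m n} (P : PLMap m) (Q : PLMap n) → end P ≡ start Q → end (P ⊕ Q) ≡ end Q
end-⊕ {zero}  {zero}  P Q end≡start = end≡start
end-⊕ {zero}  {suc n} P Q end≡start = refl
end-⊕ {suc m} {n}     P Q end≡start =
  trans (tail-++ (endpoint P) _ (fromℕ (m ℕ.+ n))) (end-⊕ (dropFirstPiece P) Q end≡start)

Increasing-⊕ : ∀ {m n} (P : PLMap m) (Q : PLMap n) → end P ≡ start Q →
               Increasing P → Increasing Q → Increasing (P ⊕ Q)
Increasing-⊕ {zero}  P Q end≡start _ incQ zero = subst (_< endpoint Q (suc zero)) (sym end≡start) (incQ zero)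
Increasing-⊕ {zero}  P Q end≡start _ incQ (suc j) = incQ (suc j)
Increasing-⊕ {suc m} P Q end≡start incP _ zero = incP zero
Increasing-⊕ {suc m} P Q end≡start incP incQ (suc j) =
  subst₂ _<_ (sym (tail-++ (endpoint P) _ (inject₁ j))) (sym (tail-++ (endpoint P) _ (suc j)))
    (Increasing-⊕ (dropFirstPiece P) Q end≡start (incP ∘ suc) incQ j)

⟦⊕⟧ˡ : ∀ {m n} (P : PLMap m) (Q : PLMap n) {x} → x ∈[ start P , end P ⟩ → ⟦ P ⊕ Q ⟧ x ≡ ⟦ P ⟧ x
⟦⊕⟧ˡ {zero}  P Q x∈ = ⊥-elim (∈-empty x∈)
⟦⊕⟧ˡ {suc m} P Q {x} (_ , x<end) with <⊎≥ x (endpoint P (suc zero))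
... | inj₁ x<e₁ = trans (evalPL-here _ _ _ x<e₁) (sym (evalPL-here _ _ _ x<e₁))
... | inj₂ e₁≤x = begin
  ⟦ P ⊕ Q ⟧ x                  ≡⟨ evalPL-there _ _ _ e₁≤x ⟩
  ⟦ dropFirstPiece (P ⊕ Q) ⟧ x ≡⟨ ⟦dropFirstPiece-⊕⟧ P Q x ⟩
  ⟦ dropFirstPiece P ⊕ Q ⟧ x   ≡⟨ ⟦⊕⟧ˡ (dropFirstPiece P) Q (e₁≤x , x<end) ⟩
  ⟦ dropFirstPiece P ⟧ x       ≡⟨ evalPL-there _ _ _ e₁≤x ⟨
  ⟦ P ⟧ x                      ∎
  where open ≡-Reasoning

⟦⊕⟧ʳ : ∀ {m n} (P : PLMap m) (Q : PLMap n) {x} → Increasing P → end P ≡ start Q → start Q ≤ x →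
       ⟦ P ⊕ Q ⟧ x ≡ ⟦ Q ⟧ x
⟦⊕⟧ʳ {zero} {n} P Q {x} _ end≡start _ = evalPL-cong n endpoints≗ (λ _ → refl) (λ _ → refl) x
  where
  endpoints≗ : endpoint P ++ tail (endpoint Q) ≗ endpoint Q
  endpoints≗ zero    = end≡start
  endpoints≗ (suc i) = refl
⟦⊕⟧ʳ {suc m} P Q {x} incP end≡start start≤x = begin
  ⟦ P ⊕ Q ⟧ x                  ≡⟨ evalPL-there _ _ _ e₁≤x ⟩
  ⟦ dropFirstPiece (P ⊕ Q) ⟧ x ≡⟨ ⟦dropFirstPiece-⊕⟧ P Q x ⟩
  ⟦ dropFirstPiece P ⊕ Q ⟧ x   ≡⟨ ⟦⊕⟧ʳ (dropFirstPiece P) Q (incP ∘ suc) end≡start start≤x ⟩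
  ⟦ Q ⟧ x                      ∎
  where
  open ≡-Reasoning
  e₁≤x : endpoint P (suc zero) ≤ x
  e₁≤x = ≤-trans (start≤end (dropFirstPiece P) (incP ∘ suc)) (≤-trans (≤-reflexive end≡start) start≤x)

iter-suc : ∀ k (f : ℤ → ℤ) x → iter (suc k) f x ≡ iter k f (f x)
iter-suc zero    f x = refl
iter-suc (suc k) f x = cong f (iter-suc k f x)

module Cycle (n : ℕ) where

  N : ℤ
  N = + n

  apply-∈ : ∀ (T : PLBij 0ℤ N) {u} → u ∈[ 0ℤ , N ⟩ → apply T u ∈[ 0ℤ , N ⟩
  apply-∈ T (0≤u , u<N) = proj₁ (bij T) _ 0≤u u<N

  block : ∀ (T : PLBij 0ℤ N) → ℤ → ℤ → PLMap (m T)
  block T s t = translate s t (plMap (e T) (a T) (b T))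

  start-block : ∀ T s t → start (block T s t) ≡ s
  start-block T s t = trans (cong (_+ s) (e-first T)) (+-identityˡ s)

  end-block : ∀ T s t → end (block T s t) ≡ s + N
  end-block T s t = trans (cong (_+ s) (e-last T)) (+-comm N s)

  Increasing-block : ∀ T s t → Increasing (block T s t)
  Increasing-block T s t j = +-monoˡ-< s (e-incr T j)

  ⟦block⟧ : ∀ T s t {u} → u ∈[ 0ℤ , N ⟩ → ⟦ block T s t ⟧ (u + s) ≡ apply T u + t
  ⟦block⟧ T s t {u} u∈ =
    ⟦translate⟧ s t (plMap (e T) (a T) (b T)) (subst₂ (λ L R → u ∈[ L , R ⟩) (sym (e-first T)) (sym (e-last T)) u∈)

  BijOnto-block : ∀ T s t → BijOnto s (s + N) (_∈[ t , t + N ⟩) ⟦ block T s t ⟧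
  BijOnto-block T s t = BijOnto-translate s t (bij T) (⟦block⟧ T s t)

  chainPieces : ∀ {k} → Vec (PLBij 0ℤ N) (suc k) → ℕ
  chainPieces (T ∷ [])          = m T
  chainPieces (T ∷ Ts@(_ ∷ _)) = m T ℕ.+ chainPieces Ts

  chain : ∀ {k} (Ts : Vec (PLBij 0ℤ N) (suc k)) → ℤ → PLMap (chainPieces Ts)
  chain (T ∷ [])          s = block T s 0ℤ
  chain (T ∷ Ts@(_ ∷ _)) s = block T s (s + N) ⊕ chain Ts (s + N)

  chainEnd : ℕ → ℤ → ℤ
  chainEnd zero    s = s + N
  chainEnd (suc k) s = chainEnd k (s + N)

  chainPieces≡sum : ∀ {k} (Ts : Vec (PLBij 0ℤ N) (suc k)) → chainPieces Ts ≡ sum (map m Ts)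
  chainPieces≡sum (T ∷ [])          = sym (ℕₚ.+-identityʳ (m T))
  chainPieces≡sum (T ∷ Ts@(_ ∷ _)) = cong (m T ℕ.+_) (chainPieces≡sum Ts)

  chainEnd≡ : ∀ k s → chainEnd k s ≡ s + + (suc k * n)
  chainEnd≡ zero    s = cong (λ w → s + + w) (sym (ℕₚ.+-identityʳ n))
  chainEnd≡ (suc k) s = trans (chainEnd≡ k (s + N)) (+-assoc s N _)

  s+N≤chainEnd : ∀ k s → s + N ≤ chainEnd k s
  s+N≤chainEnd zero    s = ≤-refl
  s+N≤chainEnd (suc k) s = ≤-trans (i≤i+j (s + N) N) (s+N≤chainEnd k (s + N))

  start-chain : ∀ {k} (Ts : Vec (PLBij 0ℤ N) (suc k)) s → start (chain Ts s) ≡ s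
  start-chain (T ∷ [])          s = start-block T s 0ℤ
  start-chain (T ∷ Ts@(_ ∷ _)) s = start-block T s (s + N)

  block-meets-chain : ∀ {k} T (Ts : Vec (PLBij 0ℤ N) (suc k)) s →
                      end (block T s (s + N)) ≡ start (chain Ts (s + N))
  block-meets-chain T Ts s = trans (end-block T s (s + N)) (sym (start-chain Ts (s + N)))

  end-chain : ∀ {k} (Ts : Vec (PLBij 0ℤ N) (suc k)) s → end (chain Ts s) ≡ chainEnd k s
  end-chain (T ∷ [])          s = end-block T s 0ℤ
  end-chain (T ∷ Ts@(_ ∷ _)) s =
    trans (end-⊕ (block T s (s + N)) (chain Ts (s + N)) (block-meets-chain T Ts s)) (end-chain Ts (s + N))

  Increasing-chain : ∀ {k} (Ts : Vec (PLBij 0ℤ N) (suc k)) s → Increasing (chain Ts s)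
  Increasing-chain (T ∷ [])          s = Increasing-block T s 0ℤ
  Increasing-chain (T ∷ Ts@(_ ∷ _)) s =
    Increasing-⊕ (block T s (s + N)) (chain Ts (s + N)) (block-meets-chain T Ts s)
      (Increasing-block T s (s + N)) (Increasing-chain Ts (s + N))

  ⟦chain⟧-head : ∀ {k} T (Ts : Vec (PLBij 0ℤ N) (suc k)) s {x} → x ∈[ s , s + N ⟩ →
                 ⟦ chain (T ∷ Ts) s ⟧ x ≡ ⟦ block T s (s + N) ⟧ x
  ⟦chain⟧-head T Ts@(_ ∷ _) s {x} x∈ =
    ⟦⊕⟧ˡ (block T s (s + N)) (chain Ts (s + N))
      (subst₂ (λ L R → x ∈[ L , R ⟩) (sym (start-block T s (s + N))) (sym (end-block T s (s + N))) x∈)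

  ⟦chain⟧-tail : ∀ {k} T (Ts : Vec (PLBij 0ℤ N) (suc k)) s {x} → s + N ≤ x →
                 ⟦ chain (T ∷ Ts) s ⟧ x ≡ ⟦ chain Ts (s + N) ⟧ x
  ⟦chain⟧-tail T Ts@(_ ∷ _) s {x} s+N≤x =
    ⟦⊕⟧ʳ (block T s (s + N)) (chain Ts (s + N)) (Increasing-block T s (s + N)) (block-meets-chain T Ts s)
      (subst (_≤ x) (sym (start-chain Ts (s + N))) s+N≤x)

  BijOnto-chain : ∀ {k} (Ts : Vec (PLBij 0ℤ N) (suc k)) {s} → 0ℤ ≤ s →
    BijOnto s (chainEnd k s) (λ y → y ∈[ s + N , chainEnd k s ⟩ ⊎ y ∈[ 0ℤ , N ⟩) ⟦ chain Ts s ⟧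
  BijOnto-chain (T ∷ []) {s} _ = BijOnto-resp-⇔ inj₂ from-target (BijOnto-block T s 0ℤ)
    where
    from-target : ∀ {y} → y ∈[ s + N , s + N ⟩ ⊎ y ∈[ 0ℤ , N ⟩ → y ∈[ 0ℤ , N ⟩
    from-target (inj₁ y∈) = ⊥-elim (∈-empty y∈)
    from-target (inj₂ y∈) = y∈
  BijOnto-chain {suc k} (T ∷ Ts@(_ ∷ _)) {s} 0≤s =
    BijOnto-resp-⇔ (map₁ (∈-merge (i≤i+j (s + N) N) (s+N≤chainEnd k (s + N))) ∘ assocˡ)
                   (assocʳ ∘ map₁ (∈-split (s + N + N)))
      (BijOnto-⊎ (i≤i+j s N) (s+N≤chainEnd (suc k) s) disjoint
        (BijOnto-resp-≗ (sym ∘ ⟦chain⟧-head T Ts s) (BijOnto-block T s (s + N)))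
        (BijOnto-resp-≗ (sym ∘ ⟦chain⟧-tail T Ts s ∘ proj₁) (BijOnto-chain Ts (≤-trans 0≤s (i≤i+j s N)))))
    where
    disjoint : ∀ {y} → y ∈[ s + N , s + N + N ⟩ → ¬ (y ∈[ s + N + N , chainEnd k (s + N) ⟩ ⊎ y ∈[ 0ℤ , N ⟩)
    disjoint (_ , y<s+2N)   (inj₁ (s+2N≤y , _)) = ∈-empty (s+2N≤y , y<s+2N)
    disjoint (s+N≤y , _)    (inj₂ (_ , y<N))    = ∈-empty (≤-trans (+-monoˡ-≤ N 0≤s) s+N≤y , y<N)

  iter-chain : ∀ (f : ℤ → ℤ) {k} (Ts : Vec (PLBij 0ℤ N) (suc k)) s →
               (∀ {x} → x ∈[ s , chainEnd k s ⟩ → f x ≡ ⟦ chain Ts s ⟧ x) →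
               ∀ {u} → u ∈[ 0ℤ , N ⟩ → iter (suc k) f (u + s) ≡ applySeq Ts u
  iter-chain f (T ∷ []) s f≡chain u∈ =
    trans (f≡chain (∈-from-origin s u∈)) (trans (⟦block⟧ T s 0ℤ u∈) (+-identityʳ _))
  iter-chain f {suc k} (T ∷ Ts@(_ ∷ _)) s f≡chain {u} u∈ = begin
    iter (suc (suc k)) f (u + s)         ≡⟨ iter-suc (suc k) f (u + s) ⟩
    iter (suc k) f (f (u + s))           ≡⟨ cong (iter (suc k) f) f-on-head ⟩
    iter (suc k) f (apply T u + (s + N)) ≡⟨ iter-chain f Ts (s + N) f≡chain-tail (apply-∈ T u∈) ⟩
    applySeq Ts (apply T u)              ∎
    where
    open ≡-Reasoning
    f-on-head : f (u + s) ≡ apply T u + (s + N)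
    f-on-head =
      let (s≤u+s , u+s<s+N) = ∈-from-origin s u∈
      in trans (f≡chain (s≤u+s , <-≤-trans u+s<s+N (s+N≤chainEnd (suc k) s)))
           (trans (⟦chain⟧-head T Ts s (s≤u+s , u+s<s+N)) (⟦block⟧ T s (s + N) u∈))
    f≡chain-tail : ∀ {x} → x ∈[ s + N , chainEnd k (s + N) ⟩ → f x ≡ ⟦ chain Ts (s + N) ⟧ x
    f≡chain-tail (s+N≤x , x<end) =
      trans (f≡chain (≤-trans (i≤i+j s N) s+N≤x , x<end)) (⟦chain⟧-tail T Ts s s+N≤x)

  BijOnto-chain₀ : ∀ {k} (Ts : Vec (PLBij 0ℤ N) (suc k)) →
                   BijOnto 0ℤ (chainEnd k 0ℤ) (_∈[ 0ℤ , chainEnd k 0ℤ ⟩) ⟦ chain Ts 0ℤ ⟧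
  BijOnto-chain₀ {k} Ts =
    BijOnto-resp-⇔ (∈-merge (+≤+ ℕ.z≤n) (s+N≤chainEnd k 0ℤ) ∘ swap) (swap ∘ ∈-split N)
      (BijOnto-chain Ts ≤-refl)

  cycle : ∀ {k} → Vec (PLBij 0ℤ N) (suc k) → PLBij 0ℤ (+ (suc k * n))
  cycle {k} Ts = record
    { m       = chainPieces Ts
    ; e       = endpoint (chain Ts 0ℤ)
    ; a       = slope (chain Ts 0ℤ)
    ; b       = intercept (chain Ts 0ℤ)
    ; e-first = start-chain Ts 0ℤ
    ; e-last  = trans (end-chain Ts 0ℤ) (chainEnd≡ k 0ℤ)
    ; e-incr  = Increasing-chain Ts 0ℤ
    ; bij     = toIsBijOn (subst (λ R → BijOnto 0ℤ R (_∈[ 0ℤ , R ⟩) ⟦ chain Ts 0ℤ ⟧)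
                                 (chainEnd≡ k 0ℤ) (BijOnto-chain₀ Ts))
    }

emptyPLBij : PLBij 0ℤ 0ℤ
emptyPLBij = record
  { m = 0 ; e = λ _ → 0ℤ ; a = λ () ; b = λ ()
  ; e-first = refl ; e-last = refl ; e-incr = λ ()
  ; bij = toIsBijOn (record
      { into = ⊥-elim ∘ ∈-empty ; inj = λ x∈ → ⊥-elim (∈-empty x∈) ; onto = ⊥-elim ∘ ∈-empty })
  }

lemma23 : (n k : ℕ) (Ts : Vec (PLBij (+ 0) (+ n)) k) →
    Σ (PLBij (+ 0) (+ (k * n))) λ T̂ →
    (PLBij.m T̂ ≡ sum (map PLBij.m Ts))
    × (∀ x → + 0 ≤ x → x < + n → applySeq Ts x ≡ iter k (apply T̂) x)
lemma23 n zero    []  = emptyPLBij , refl , λ _ _ _ → refl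
lemma23 n (suc k) Ts  = T̂ , chainPieces≡sum Ts , λ x 0≤x x<n → begin
  applySeq Ts x                ≡⟨ iter-chain (apply T̂) Ts 0ℤ (λ _ → refl) (0≤x , x<n) ⟨
  iter (suc k) (apply T̂) (x + 0ℤ) ≡⟨ cong (iter (suc k) (apply T̂)) (+-identityʳ x) ⟩
  iter (suc k) (apply T̂) x     ∎
  where
  open Cycle n
  open ≡-Reasoning
  T̂ : PLBij 0ℤ (+ (suc k * n))
  T̂ = cycle Ts
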